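{- Let $G=(U\cup W,E)$ be a circular graph. Then for any two distinct vertices $w_1,w_2\in W$ we have $cn(w_1,w_2)\le 2$, i.e. $w_1$ and $w_2$ have at most two common neighbours.
   Context: All graphs are finite and simple. For vertices $v_1,\dots,v_k$, $CN(v_1,\dots,v_k)$ denotes the set of their common neighbours and $cn(v_1,\dots,v_k)=|CN(v_1,\dots,v_k)|$. A circular graph is a finite bipartite graph $G$ with a specified bipartition $V(G)=U\cup W$ ($U\cap W=\emptyset$, every edge joins $U$ to $W$) such that (i) $cn(u_i,u_j,u_k)=1$ for all distinct $u_i,u_j,u_k\in U$, and (ii) $d(w)\ge 3$ for every $w\in W$. -}

module Defs where

open import Data.Nat using (ℕ; _≤_; _≥_)
open import Data.Fin using (Fin)
open import Data.Bool using (Bool; true; false; _∧_)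
open import Data.List using (List; length; filterᵇ; allFin)
open import Relation.Binary.PropositionalEquality using (_≡_; _≢_)

-- A finite bipartite graph with a specified bipartition V = U ∪ W,
-- U = Fin m, W = Fin n (disjoint by construction), every edge joins U to W.
record BipartiteGraph (m n : ℕ) : Set where
  field
    adj : Fin m → Fin n → Bool

open BipartiteGraph public

module _ {m n : ℕ} (G : BipartiteGraph m n) where

  cnU3 : Fin m → Fin m → Fin m → ℕ
  cnU3 a b c = length (filterᵇ (λ w → adj G a w ∧ adj G b w ∧ adj G c w) (allFin n))

  cnW2 : Fin n → Fin n → ℕ
  cnW2 w₁ w₂ = length (filterᵇ (λ u → adj G u w₁ ∧ adj G u w₂) (allFin m))

  degW : Fin n → ℕ
  degW w = length (filterᵇ (λ u → adj G u w) (allFin m))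

  record IsCircular : Set where
    field
      cn-triple : ∀ a b c → a ≢ b → a ≢ c → b ≢ c → cnU3 a b c ≡ 1
      deg-W     : ∀ w → degW w ≥ 3

-- Three distinct common neighbours a, b, c of w₁ and w₂ would make both w₁
-- and w₂ common neighbours of the triple a, b, c, contradicting cn(a,b,c) = 1.
module Submission where

open import Defs
open import Data.Nat using (ℕ; _≤_; _≤?_; s≤s; z≤n)
open import Data.Nat.Properties using (≰⇒>; m≤n⇒m≤1+n)
open import Data.Fin using (Fin)
open import Data.Bool using (Bool; T; _∧_)
open import Data.Bool.Properties using (T-∧)
open import Data.Product using (_×_; _,_; proj₂; ∃-syntax)
open import Data.List using (List; []; _∷_; length; filterᵇ; allFin)
open import Data.List.Relation.Unary.Any using (here; there)
open import Data.List.Relation.Unary.All using (_∷_)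
open import Data.List.Relation.Unary.AllPairs using (_∷_)
open import Data.List.Relation.Unary.Unique.Propositional using (Unique)
open import Data.List.Relation.Unary.Unique.Propositional.Properties using (allFin⁺; filter⁺)
open import Data.List.Membership.Propositional using (_∈_)
open import Data.List.Membership.Propositional.Properties using (∈-filter⁺; ∈-filter⁻; ∈-allFin)
open import Function.Bundles using (Equivalence)
open import Relation.Nullary using (yes; no; contradiction)
open import Relation.Nullary.Decidable using (T?)
open import Relation.Binary.PropositionalEquality using (_≢_; refl; subst)

module _ {A : Set} where

  ∈⇒1≤length : ∀ {x} {xs : List A} → x ∈ xs → 1 ≤ length xs
  ∈⇒1≤length (here _)  = s≤s z≤n
  ∈⇒1≤length (there _) = s≤s z≤n

  Unique⇒2≤length : ∀ {xs : List A} {x y} → Unique xs →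
                    x ∈ xs → y ∈ xs → x ≢ y → 2 ≤ length xs
  Unique⇒2≤length _          (here refl) (here refl) x≢y = contradiction refl x≢y
  Unique⇒2≤length _          (here refl) (there y∈)  _   = s≤s (∈⇒1≤length y∈)
  Unique⇒2≤length _          (there x∈)  (here refl) _   = s≤s (∈⇒1≤length x∈)
  Unique⇒2≤length (_ ∷ uniq) (there x∈)  (there y∈)  x≢y =
    m≤n⇒m≤1+n (Unique⇒2≤length uniq x∈ y∈ x≢y)

  Unique⇒three-distinct : ∀ {xs : List A} → Unique xs → 3 ≤ length xs →
    ∃[ a ] ∃[ b ] ∃[ c ] (a ∈ xs × b ∈ xs × c ∈ xs × a ≢ b × a ≢ c × b ≢ c)
  Unique⇒three-distinct {a ∷ b ∷ c ∷ _} ((a≢b ∷ a≢c ∷ _) ∷ (b≢c ∷ _) ∷ _) _ =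
    a , b , c , here refl , there (here refl) , there (there (here refl)) ,
    a≢b , a≢c , b≢c
  Unique⇒three-distinct {[]}         _ ()
  Unique⇒three-distinct {_ ∷ []}     _ (s≤s ())
  Unique⇒three-distinct {_ ∷ _ ∷ []} _ (s≤s (s≤s ()))

  Unique-filterᵇ : ∀ (p : A → Bool) {xs : List A} → Unique xs → Unique (filterᵇ p xs)
  Unique-filterᵇ p = filter⁺ (λ x → T? (p x))

  ∈-filterᵇ⁺ : ∀ (p : A → Bool) {x xs} → x ∈ xs → T (p x) → x ∈ filterᵇ p xs
  ∈-filterᵇ⁺ p = ∈-filter⁺ (λ x → T? (p x))

  ∈-filterᵇ⁻ : ∀ (p : A → Bool) {x xs} → x ∈ filterᵇ p xs → T (p x)
  ∈-filterᵇ⁻ p {xs = xs} x∈ = proj₂ (∈-filter⁻ (λ x → T? (p x)) {xs = xs} x∈)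

Unique-filterᵇ-allFin : ∀ {k} (p : Fin k → Bool) → Unique (filterᵇ p (allFin k))
Unique-filterᵇ-allFin {k} p = Unique-filterᵇ p (allFin⁺ k)

module _ {m n : ℕ} (G : BipartiteGraph m n) where

  Adj : Fin m → Fin n → Set
  Adj u w = T (adj G u w)

  common-neighbour⁺ : ∀ {a b c w} → Adj a w → Adj b w → Adj c w →
                      T (adj G a w ∧ adj G b w ∧ adj G c w)
  common-neighbour⁺ aw bw cw =
    Equivalence.from T-∧ (aw , Equivalence.from T-∧ (bw , cw))

  two-common-neighbours⇒2≤cnU3 : ∀ {a b c w₁ w₂} → w₁ ≢ w₂ →
    Adj a w₁ → Adj b w₁ → Adj c w₁ → Adj a w₂ → Adj b w₂ → Adj c w₂ →
    2 ≤ cnU3 G a b c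
  two-common-neighbours⇒2≤cnU3 {a} {b} {c} {w₁} {w₂} w₁≢w₂ aw₁ bw₁ cw₁ aw₂ bw₂ cw₂ =
    Unique⇒2≤length (Unique-filterᵇ-allFin p)
      (∈-filterᵇ⁺ p (∈-allFin w₁) (common-neighbour⁺ aw₁ bw₁ cw₁))
      (∈-filterᵇ⁺ p (∈-allFin w₂) (common-neighbour⁺ aw₂ bw₂ cw₂))
      w₁≢w₂
    where p = λ w → adj G a w ∧ adj G b w ∧ adj G c w

  ∈-commonNeighboursW⁻ : ∀ {u w₁ w₂} →
    u ∈ filterᵇ (λ u → adj G u w₁ ∧ adj G u w₂) (allFin m) → Adj u w₁ × Adj u w₂
  ∈-commonNeighboursW⁻ {w₁ = w₁} {w₂} u∈ =
    Equivalence.to T-∧ (∈-filterᵇ⁻ (λ u → adj G u w₁ ∧ adj G u w₂) {xs = allFin m} u∈)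

  3≤cnW2⇒distinct-triple-with-2≤cnU3 : ∀ {w₁ w₂} → w₁ ≢ w₂ → 3 ≤ cnW2 G w₁ w₂ →
    ∃[ a ] ∃[ b ] ∃[ c ] (a ≢ b × a ≢ c × b ≢ c × 2 ≤ cnU3 G a b c)
  3≤cnW2⇒distinct-triple-with-2≤cnU3 {w₁} {w₂} w₁≢w₂ 3≤cn
    with Unique⇒three-distinct (Unique-filterᵇ-allFin (λ u → adj G u w₁ ∧ adj G u w₂)) 3≤cn
  ... | a , b , c , a∈ , b∈ , c∈ , a≢b , a≢c , b≢c
    with ∈-commonNeighboursW⁻ a∈ | ∈-commonNeighboursW⁻ b∈ | ∈-commonNeighboursW⁻ c∈
  ... | aw₁ , aw₂ | bw₁ , bw₂ | cw₁ , cw₂ =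
    a , b , c , a≢b , a≢c , b≢c ,
    two-common-neighbours⇒2≤cnU3 w₁≢w₂ aw₁ bw₁ cw₁ aw₂ bw₂ cw₂

lemma2p3 : ∀ {m n : ℕ} (G : BipartiteGraph m n) → IsCircular G →
           ∀ (w₁ w₂ : Fin n) → w₁ ≢ w₂ → cnW2 G w₁ w₂ ≤ 2
lemma2p3 G circular w₁ w₂ w₁≢w₂ with cnW2 G w₁ w₂ ≤? 2
... | yes cn≤2 = cn≤2
... | no  cn≰2 with 3≤cnW2⇒distinct-triple-with-2≤cnU3 G w₁≢w₂ (≰⇒> cn≰2)
... | a , b , c , a≢b , a≢c , b≢c , 2≤cn =
  contradiction (subst (2 ≤_) (IsCircular.cn-triple circular a b c a≢b a≢c b≢c) 2≤cn)
                λ { (s≤s ()) }
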